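{- For every positive integer $n$: (a) $M_2(S_n\times S_n)\ge (n-1)!$; (b) $M_{2,n}(S_n\times S_n)\ge n!$; (c) $M_2(A_n\times A_n)\ge (n-1)!/2$; (d) $M_{2,n}(A_n\times A_n)\ge n!/2$.
   Context: For a group $\Gamma$ and positive integers $k,g$, a set $A\subseteq\Gamma$ is an $S_k[g]$-set if for every $\mu\in\Gamma$ there are at most $g$ words $(\alpha_1,\ldots,\alpha_k)\in A^k$ with $\alpha_1\cdots\alpha_k=\mu$; an $S_k$-set is an $S_k[1]$-set. $M_{k,g}(\Gamma)$ is the maximum size of an $S_k[g]$-set in $\Gamma$, and $M_k(\Gamma)=M_{k,1}(\Gamma)$. $S_n$ and $A_n$ are the symmetric and alternating groups on $n$ letters. -}

module Defs where

open import Data.Nat using (ℕ; _≤_; _<?_)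
open import Data.Nat.Divisibility using (_∣_)
open import Data.Fin using (Fin)
import Data.Fin
open import Data.Fin.Properties using () renaming (_≟_ to _≟ᶠ_)
open import Data.Vec using (Vec; lookup; tabulate)
open import Data.Vec.Properties using (≡-dec)
open import Data.List using (List; length; filter; cartesianProduct; allFin)
open import Data.List.Relation.Unary.All using (All)
open import Data.List.Relation.Unary.Unique.Propositional using (Unique)
open import Data.Product using (_×_; _,_)
open import Data.Product.Properties using () renaming (≡-dec to ×-≡-dec)
open import Relation.Nullary using (Dec)
open import Relation.Nullary.Decidable using (_×-dec_)
open import Relation.Binary.PropositionalEquality using (_≡_)

-- A permutation of Fin n is represented by its table of values
-- (σ(0), …, σ(n-1)), subject to injectivity.
Perm : ℕ → Set
Perm n = Vec (Fin n) n

IsPerm : ∀ {n} → Perm n → Set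
IsPerm σ = ∀ i j → lookup σ i ≡ lookup σ j → i ≡ j

_∘ₚ_ : ∀ {n} → Perm n → Perm n → Perm n
σ ∘ₚ τ = tabulate (λ i → lookup σ (lookup τ i))

_≟ₚ_ : ∀ {n} (σ τ : Perm n) → Dec (σ ≡ τ)
_≟ₚ_ = ≡-dec _≟ᶠ_

inversions : ∀ {n} → Perm n → ℕ
inversions {n} σ =
  length (filter (λ { (i , j) → (Data.Fin._<?_ i j) ×-dec (Data.Fin._<?_ (lookup σ j) (lookup σ i)) })
                 (cartesianProduct (allFin n) (allFin n)))

IsEven : ∀ {n} → Perm n → Set
IsEven σ = 2 ∣ inversions σ

Elt : ℕ → Set
Elt n = Perm n × Perm n

_·_ : ∀ {n} → Elt n → Elt n → Elt n
(σ₁ , τ₁) · (σ₂ , τ₂) = (σ₁ ∘ₚ σ₂ , τ₁ ∘ₚ τ₂)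

_≟ₑ_ : ∀ {n} (x y : Elt n) → Dec (x ≡ y)
_≟ₑ_ = ×-≡-dec _≟ₚ_ _≟ₚ_

InSS : ∀ {n} → Elt n → Set
InSS (σ , τ) = IsPerm σ × IsPerm τ

InAA : ∀ {n} → Elt n → Set
InAA (σ , τ) = (IsPerm σ × IsEven σ) × (IsPerm τ × IsEven τ)

reps2 : ∀ {n} → List (Elt n) → Elt n → ℕ
reps2 A μ = length (filter (λ { (a , b) → (a · b) ≟ₑ μ }) (cartesianProduct A A))

IsS2g : ∀ {n} (InΓ : Elt n → Set) → ℕ → List (Elt n) → Set
IsS2g InΓ g A = Unique A × All InΓ A × (∀ μ → InΓ μ → reps2 A μ ≤ g)

module Submission where

-- Let δ be the cycle 0 ↦ 1 ↦ ⋯ ↦ M ↦ 0 on Fin n, where M is the largest even number below n,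
-- and embed x ↦ (x , x δ).  If (x , xδ)(y , yδ) = (x′ , x′δ)(y′ , y′δ), then xy = x′y′ and
-- xδyδ = x′δy′δ, and together these show that the set of points where x and x′ agree is closed
-- under δ.  So x(0) = x′(0) forces x and x′ to agree on 0, …, M, i.e. everywhere except possibly
-- at the last point, hence (both being bijections) everywhere; then y = y′ as well.  The number
-- of representations of a product is therefore at most the number of values x(0) can take:
-- 1 on the permutations fixing 0 and n on all of S_n.  As δ is a cycle of odd length it is
-- even, so the same embedding works inside A_n, which has n!/2 elements.

open import Defs
import Algebra.Properties.CommutativeSemigroup as CommutativeSemigroupProperties
open import Data.Bool using (true; false)
open import Data.Fin as Fin using (Fin; zero; suc; toℕ; inject₁; fromℕ; punchIn; punchOut)
open import Data.Fin.Induction using (<-weakInduction)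
import Data.Fin.Properties as Fin
open import Data.List as List using (List; []; _∷_; _++_; length; filter; cartesianProduct; allFin; map)
open import Data.List.Membership.Propositional using (_∈_)
open import Data.List.Membership.Propositional.Properties
import Data.List.Properties as List
open import Data.List.Relation.Unary.All as All using (All; []; _∷_)
import Data.List.Relation.Unary.All.Properties as All
open import Data.List.Relation.Unary.AllPairs using ([]; _∷_)
open import Data.List.Relation.Unary.Any using (here; there)
open import Data.List.Relation.Unary.Unique.Propositional using (Unique)
import Data.List.Relation.Unary.Unique.Propositional.Properties as Unique
open import Data.Nat as ℕ using (ℕ; zero; suc; _+_; _*_; _∸_; _≤_; z≤n; s≤s; _!; parity)
open import Data.Nat.Divisibility using (_∣_; divides; _∣?_; _∣0; ∣-refl; ∣m∣n⇒∣m+n)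
open import Data.Nat.ListAction using (sum)
import Data.Nat.Properties as ℕ
open import Data.Parity.Base as ℙ using (0ℙ; 1ℙ)
import Data.Parity.Properties as ℙ
open import Data.Product as Product using (_×_; _,_; proj₁; proj₂; ∃-syntax; Σ)
open import Data.Sum using (inj₁; inj₂)
open import Data.Vec as Vec using (Vec; []; _∷_; lookup; count)
import Data.Vec.Properties as Vec
open import Data.Vec.Relation.Unary.All as VecAll using ([]; _∷_)
import Data.Vec.Relation.Unary.All.Properties as VecAll
open import Data.Vec.Relation.Unary.AllPairs using ([]; _∷_)
import Data.Vec.Relation.Unary.Unique.Propositional as VecUnique
import Data.Vec.Relation.Unary.Unique.Propositional.Properties as VecUnique
open import Function using (_∘_; id)
open import Function.Definitions using (Injective; StrictlySurjective)
open import Level using (0ℓ)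
open import Relation.Binary.Definitions using (tri<; tri≈; tri>)
open import Relation.Binary.PropositionalEquality
open import Relation.Nullary using (yes; no; does; ¬_; ¬?; contradiction)
open import Relation.Nullary.Decidable using (_×-dec_)
open import Relation.Unary using (Pred; Decidable)

private
  variable
    A B : Set
    k m n : ℕ

module ℕ+ = CommutativeSemigroupProperties ℕ.+-commutativeSemigroup
module ℙ+ = CommutativeSemigroupProperties ℙ.+-commutativeSemigroup

module _ {P : Pred A 0ℓ} (P? : Decidable P) where

  length-filter-++ : ∀ xs ys → length (filter P? (xs ++ ys)) ≡ length (filter P? xs) + length (filter P? ys)
  length-filter-++ xs ys = trans (cong length (List.filter-++ P? xs ys)) (List.length-++ (filter P? xs))

  length-filter-map : (f : B → A) (xs : List B) → length (filter P? (map f xs)) ≡ length (filter (P? ∘ f) xs)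
  length-filter-map f [] = refl
  length-filter-map f (x ∷ xs) with does (P? (f x))
  ... | true  = cong suc (length-filter-map f xs)
  ... | false = length-filter-map f xs

  length-filter+length-filter-¬ : ∀ xs → length xs ≡ length (filter P? xs) + length (filter (¬? ∘ P?) xs)
  length-filter+length-filter-¬ [] = refl
  length-filter+length-filter-¬ (x ∷ xs) with P? x
  ... | yes _ = cong suc (length-filter+length-filter-¬ xs)
  ... | no _  = trans (cong suc (length-filter+length-filter-¬ xs)) (sym (ℕ.+-suc _ _))

length-filter-cartesianProduct : ∀ {P : Pred (A × B) 0ℓ} (P? : Decidable P) xs ys →
  length (filter P? (cartesianProduct xs ys)) ≡ sum (map (λ x → length (filter (P? ∘ (x ,_)) ys)) xs)
length-filter-cartesianProduct P? []       ys = refl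
length-filter-cartesianProduct P? (x ∷ xs) ys =
  trans (length-filter-++ P? (map (x ,_) ys) _)
        (cong₂ _+_ (length-filter-map P? (x ,_) ys) (length-filter-cartesianProduct P? xs ys))

length-cartesianProduct : (xs : List A) (ys : List B) → length (cartesianProduct xs ys) ≡ length xs * length ys
length-cartesianProduct []       ys = refl
length-cartesianProduct (x ∷ xs) ys =
  trans (List.length-++ (map (x ,_) ys)) (cong₂ _+_ (List.length-map (x ,_) ys) (length-cartesianProduct xs ys))

module _ {P : Pred A 0ℓ} {Q : Pred B 0ℓ} (P? : Decidable P) (Q? : Decidable Q) where

  length-filter-tabulate-cong : (f : Fin k → A) (g : Fin k → B) → (∀ i → does (P? (f i)) ≡ does (Q? (g i))) →
    length (filter P? (List.tabulate f)) ≡ length (filter Q? (List.tabulate g))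
  length-filter-tabulate-cong {k = zero} f g eq = refl
  length-filter-tabulate-cong {k = suc k} f g eq
    with does (P? (f zero)) | does (Q? (g zero)) | eq zero | length-filter-tabulate-cong (f ∘ suc) (g ∘ suc) (eq ∘ suc)
  ... | true  | .true  | refl | ih = cong suc ih
  ... | false | .false | refl | ih = ih

count≡length-filter-tabulate : {P : Pred A 0ℓ} (P? : Decidable P) (r : Vec A k) →
  count P? r ≡ length (filter P? (List.tabulate (lookup r)))
count≡length-filter-tabulate P? [] = refl
count≡length-filter-tabulate P? (w ∷ r) with does (P? w)
... | true  = cong suc (count≡length-filter-tabulate P? r)
... | false = count≡length-filter-tabulate P? r

injectiveOn⇒length≤ : ∀ {f : A → B} {xs ys} → Unique xs →
  (∀ {x y} → x ∈ xs → y ∈ xs → f x ≡ f y → x ≡ y) → (∀ {x} → x ∈ xs → f x ∈ ys) →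
  length xs ≤ length ys
injectiveOn⇒length≤ {xs = []} _ _ _ = z≤n
injectiveOn⇒length≤ {f = f} {xs = x ∷ xs} (x∉xs ∷ xs-unique) f-injective f-into
  with ys₁ , ys₂ , refl ← ∈-∃++ (f-into (here refl)) =
  ℕ.≤-trans (s≤s (injectiveOn⇒length≤ xs-unique (λ p q → f-injective (there p) (there q)) f-into′))
            (ℕ.≤-reflexive (sym (List.length-++-sucʳ ys₁ (f x) ys₂)))
  where
  f-into′ : ∀ {y} → y ∈ xs → f y ∈ ys₁ ++ ys₂
  f-into′ {y} y∈xs with ∈-++⁻ ys₁ (f-into (there y∈xs))
  ... | inj₁ fy∈ys₁         = ∈-++⁺ˡ fy∈ys₁
  ... | inj₂ (here fy≡fx)   = contradiction (f-injective (here refl) (there y∈xs) (sym fy≡fx)) (All.lookup x∉xs y∈xs)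
  ... | inj₂ (there fy∈ys₂) = ∈-++⁺ʳ ys₁ fy∈ys₂

map-injective : ∀ {f : A → B} → Injective _≡_ _≡_ f → Injective _≡_ _≡_ (Vec.map {n = n} f)
map-injective f-injective {[]}     {[]}     _  = refl
map-injective f-injective {x ∷ xs} {y ∷ ys} eq =
  cong₂ _∷_ (f-injective (Vec.∷-injectiveˡ eq)) (map-injective f-injective (Vec.∷-injectiveʳ eq))

unique-map⁻ : ∀ {f : A → B} {xs : Vec A n} → VecUnique.Unique (Vec.map f xs) → VecUnique.Unique xs
unique-map⁻ {xs = []} [] = []
unique-map⁻ {f = f} {xs = x ∷ xs} (fx∉fxs ∷ fxs-unique) =
  VecAll.map (λ fx≢fy → fx≢fy ∘ cong f) (VecAll.map⁻ fx∉fxs) ∷ unique-map⁻ fxs-unique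

lookup-ext : {σ ρ : Vec A n} → (∀ i → lookup σ i ≡ lookup ρ i) → σ ≡ ρ
lookup-ext {σ = σ} {ρ} σ≗ρ =
  trans (sym (Vec.tabulate∘lookup σ)) (trans (Vec.tabulate-cong σ≗ρ) (Vec.tabulate∘lookup ρ))

moveHead : Fin (suc k) → Vec A (suc k) → Vec A (suc k)
moveHead zero    σ           = σ
moveHead (suc M) (v ∷ w ∷ r) = w ∷ moveHead M (v ∷ r)

swap : Vec A (suc (suc k)) → Vec A (suc (suc k))
swap = moveHead (suc zero)

module _ {P : Pred A 0ℓ} (P? : Decidable P) where

  count-moveHead : (M : Fin (suc k)) (σ : Vec A (suc k)) → count P? (moveHead M σ) ≡ count P? σ
  count-moveHead zero    σ           = refl
  count-moveHead (suc M) (v ∷ w ∷ r) with does (P? v) | does (P? w) | count-moveHead M (v ∷ r)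
  ... | true  | true  | ih = cong suc ih
  ... | true  | false | ih = ih
  ... | false | true  | ih = cong suc ih
  ... | false | false | ih = ih

all-moveHead : ∀ {P : Pred A 0ℓ} (M : Fin (suc k)) {σ : Vec A (suc k)} → VecAll.All P σ → VecAll.All P (moveHead M σ)
all-moveHead zero    ps             = ps
all-moveHead (suc M) (pv ∷ pw ∷ ps) = pw ∷ all-moveHead M (pv ∷ ps)

unique-moveHead : (M : Fin (suc k)) {σ : Vec A (suc k)} → VecUnique.Unique σ → VecUnique.Unique (moveHead M σ)
unique-moveHead zero    σ-unique = σ-unique
unique-moveHead (suc M) ((v≢w ∷ v∉r) ∷ w∉r ∷ r-unique) =
  all-moveHead M ((v≢w ∘ sym) ∷ w∉r) ∷ unique-moveHead M (v∉r ∷ r-unique)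

map-moveHead : (f : A → B) (M : Fin (suc k)) (σ : Vec A (suc k)) → Vec.map f (moveHead M σ) ≡ moveHead M (Vec.map f σ)
map-moveHead f zero    σ           = refl
map-moveHead f (suc M) (v ∷ w ∷ r) = cong (f w ∷_) (map-moveHead f M (v ∷ r))

lookup-moveHead : (M : Fin (suc k)) (σ : Vec A (suc k)) (i : Fin k) → toℕ i ℕ.< toℕ M →
  lookup (moveHead M σ) (inject₁ i) ≡ lookup σ (suc i)
lookup-moveHead (suc M) (v ∷ w ∷ r) zero    _         = refl
lookup-moveHead (suc M) (v ∷ w ∷ r) (suc i) (s≤s i<M) = lookup-moveHead M (v ∷ r) i i<M

lookup-∘ₚ : (σ τ : Perm n) (i : Fin n) → lookup (σ ∘ₚ τ) i ≡ lookup σ (lookup τ i)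
lookup-∘ₚ σ τ = Vec.lookup∘tabulate (λ i → lookup σ (lookup τ i))

lookup-∘ₚ-∘ₚ : (a b c d : Perm n) (i : Fin n) →
  lookup ((a ∘ₚ b) ∘ₚ (c ∘ₚ d)) i ≡ lookup a (lookup b (lookup c (lookup d i)))
lookup-∘ₚ-∘ₚ a b c d i =
  trans (lookup-∘ₚ (a ∘ₚ b) (c ∘ₚ d) i) (trans (lookup-∘ₚ a b _) (cong (lookup a ∘ lookup b) (lookup-∘ₚ c d i)))

perm-surjective : (σ : Perm n) → IsPerm σ → StrictlySurjective _≡_ (lookup σ)
perm-surjective {n = suc n} σ σ-perm k with Fin.any? (λ i → lookup σ i Fin.≟ k)
... | yes found  = found
... | no missing = contradiction (Fin.injective⇒≤ punchOut-injective) ℕ.1+n≰n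
  where
  k≢σ : ∀ i → k ≢ lookup σ i
  k≢σ i k≡σi = missing (i , sym k≡σi)
  punchOut-injective : Injective _≡_ _≡_ (λ i → punchOut (k≢σ i))
  punchOut-injective eq = σ-perm _ _ (Fin.punchOut-injective (k≢σ _) (k≢σ _) eq)

agreement-propagates : {x y x′ y′ d : A → A} →
  StrictlySurjective _≡_ d → StrictlySurjective _≡_ y → Injective _≡_ _≡_ x′ →
  (∀ i → x (y i) ≡ x′ (y′ i)) → (∀ i → x (d (y (d i))) ≡ x′ (d (y′ (d i)))) →
  ∀ {k} → x k ≡ x′ k → x (d k) ≡ x′ (d k)
agreement-propagates {x = x} {y} {x′} {y′} {d}
  d-surjective y-surjective x′-injective xy≡x′y′ xdyd≡x′dy′d {k} xk≡x′k
  with j , yj≡k ← y-surjective k with i , di≡j ← d-surjective j = begin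
  x (d k)           ≡⟨ cong (x ∘ d) ydi≡k ⟨
  x (d (y (d i)))   ≡⟨ xdyd≡x′dy′d i ⟩
  x′ (d (y′ (d i))) ≡⟨ cong (x′ ∘ d) y′di≡k ⟩
  x′ (d k)          ∎
  where
  open ≡-Reasoning
  ydi≡k : y (d i) ≡ k
  ydi≡k = trans (cong y di≡j) yj≡k
  y′di≡k : y′ (d i) ≡ k
  y′di≡k = x′-injective (trans (sym (xy≡x′y′ (d i))) (trans (cong x ydi≡k) xk≡x′k))

agree-off-point⇒agree : {x x′ : Fin n → Fin n} → Injective _≡_ _≡_ x → StrictlySurjective _≡_ x′ →
  (p : Fin n) → (∀ j → j ≢ p → x j ≡ x′ j) → ∀ j → x j ≡ x′ j
agree-off-point⇒agree {x = x} x-injective x′-surjective p agree j with j Fin.≟ p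
... | no j≢p = agree j j≢p
... | yes refl with q , x′q≡xj ← x′-surjective (x j) with q Fin.≟ j
...   | yes refl = sym x′q≡xj
...   | no q≢j   = contradiction (x-injective (trans (agree q q≢j) x′q≡xj)) q≢j

-- Enumerating permutations

extend : Fin (suc n) → Vec (Fin n) k → Vec (Fin (suc n)) (suc k)
extend v τ = v ∷ Vec.map (punchIn v) τ

extend-unique : (v : Fin (suc n)) {τ : Vec (Fin n) k} → VecUnique.Unique τ → VecUnique.Unique (extend v τ)
extend-unique v τ-unique =
  VecAll.map⁺ (VecAll.universal (λ w → Fin.punchInᵢ≢i v w ∘ sym) _) ∷
  VecUnique.map⁺ (Fin.punchIn-injective v _ _) τ-unique

extend-injective : {vτ wρ : Fin (suc n) × Vec (Fin n) k} →
  extend (proj₁ vτ) (proj₂ vτ) ≡ extend (proj₁ wρ) (proj₂ wρ) → vτ ≡ wρ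
extend-injective {vτ = v , τ} {w , ρ} eq with refl ← Vec.∷-injectiveˡ eq =
  cong (v ,_) (map-injective (Fin.punchIn-injective v _ _) (Vec.∷-injectiveʳ eq))

punchIn-preimage : {v : Fin (suc n)} {r : Vec (Fin (suc n)) k} → VecAll.All (v ≢_) r → ∃[ τ ] Vec.map (punchIn v) τ ≡ r
punchIn-preimage [] = [] , refl
punchIn-preimage (v≢w ∷ v∉r) with τ , refl ← punchIn-preimage v∉r =
  punchOut v≢w ∷ τ , cong (_∷ _) (Fin.punchIn-punchOut v≢w)

perms : ∀ n → List (Perm n)
perms zero    = [] ∷ []
perms (suc n) = map (λ vτ → extend (proj₁ vτ) (proj₂ vτ)) (cartesianProduct (allFin (suc n)) (perms n))

length-perms : ∀ n → length (perms n) ≡ n !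
length-perms zero    = refl
length-perms (suc n) = begin
  length (map _ pairs)                       ≡⟨ List.length-map _ pairs ⟩
  length pairs                               ≡⟨ length-cartesianProduct (allFin (suc n)) (perms n) ⟩
  length (allFin (suc n)) * length (perms n) ≡⟨ cong₂ _*_ (List.length-tabulate {n = suc n} id) (length-perms n) ⟩
  suc n * n !                                ∎
  where
  open ≡-Reasoning
  pairs = cartesianProduct (allFin (suc n)) (perms n)

perms-unique : ∀ n → Unique (perms n)
perms-unique zero    = [] ∷ []
perms-unique (suc n) = Unique.map⁺ extend-injective (Unique.cartesianProduct⁺ (Unique.allFin⁺ (suc n)) (perms-unique n))

∈-perms⇒unique : {σ : Perm n} → σ ∈ perms n → VecUnique.Unique σ
∈-perms⇒unique {zero}  (here refl) = []
∈-perms⇒unique {suc n} σ∈perms with (v , τ) , vτ∈ , refl ← ∈-map⁻ _ σ∈perms =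
  extend-unique v (∈-perms⇒unique (proj₂ (∈-cartesianProduct⁻ (allFin (suc n)) (perms n) vτ∈)))

unique⇒∈-perms : {σ : Perm n} → VecUnique.Unique σ → σ ∈ perms n
unique⇒∈-perms {zero}  {[]}    [] = here refl
unique⇒∈-perms {suc n} {v ∷ r} (v∉r ∷ r-unique) with τ , refl ← punchIn-preimage v∉r =
  ∈-map⁺ (λ vτ → extend (proj₁ vτ) (proj₂ vτ))
         (∈-cartesianProduct⁺ (∈-allFin v) (unique⇒∈-perms (unique-map⁻ r-unique)))

perms-entries-unique : ∀ n → All VecUnique.Unique (perms n)
perms-entries-unique n = All.tabulate ∈-perms⇒unique

-- Inversions and parity

inversions′ : Vec (Fin m) k → ℕ
inversions′ []      = 0
inversions′ (v ∷ r) = count (Fin._<? v) r + inversions′ r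

-- The formula of `inversions` for vectors of any length, so that `inversions σ` unfolds to `pairInversions σ`.
private
  pairInversions : Vec (Fin m) k → ℕ
  pairInversions {k = k} σ =
    length (filter (λ p → (proj₁ p Fin.<? proj₂ p) ×-dec (lookup σ (proj₂ p) Fin.<? lookup σ (proj₁ p)))
                   (cartesianProduct (allFin k) (allFin k)))

  row : Vec (Fin m) k → Fin k → ℕ
  row {k = k} σ i = length (filter (λ j → (i Fin.<? j) ×-dec (lookup σ j Fin.<? lookup σ i)) (allFin k))

  pairInversions≡sum-row : (σ : Vec (Fin m) k) → pairInversions σ ≡ sum (map (row σ) (allFin k))
  pairInversions≡sum-row {k = k} σ = length-filter-cartesianProduct _ (allFin k) (allFin k)

  row-zero : (v : Fin m) (r : Vec (Fin m) k) → row (v ∷ r) zero ≡ count (Fin._<? v) r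
  row-zero v r = trans (length-filter-tabulate-cong _ _ Fin.suc (lookup r) (λ _ → refl))
                       (sym (count≡length-filter-tabulate _ r))

  row-suc : (v : Fin m) (r : Vec (Fin m) k) (i : Fin k) → row (v ∷ r) (suc i) ≡ row r i
  row-suc {k = k} v r i = length-filter-tabulate-cong _ _ {k = k} Fin.suc id (λ _ → refl)

  pairInversions-∷ : (v : Fin m) (r : Vec (Fin m) k) → pairInversions (v ∷ r) ≡ count (Fin._<? v) r + pairInversions r
  pairInversions-∷ {k = k} v r = begin
    pairInversions (v ∷ r)                                              ≡⟨ pairInversions≡sum-row (v ∷ r) ⟩
    row (v ∷ r) zero + sum (map (row (v ∷ r)) (List.tabulate Fin.suc)) ≡⟨ cong₂ _+_ (row-zero v r) (cong sum rows) ⟩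
    count (Fin._<? v) r + sum (map (row r) (allFin k))                  ≡⟨ cong (count (Fin._<? v) r +_) (pairInversions≡sum-row r) ⟨
    count (Fin._<? v) r + pairInversions r                              ∎
    where
    open ≡-Reasoning
    rows : map (row (v ∷ r)) (List.tabulate Fin.suc) ≡ map (row r) (allFin k)
    rows = trans (List.map-tabulate Fin.suc (row (v ∷ r)))
                 (trans (List.tabulate-cong (row-suc v r)) (sym (List.map-tabulate id (row r))))

  pairInversions≡inversions′ : (σ : Vec (Fin m) k) → pairInversions σ ≡ inversions′ σ
  pairInversions≡inversions′ []      = refl
  pairInversions≡inversions′ (v ∷ r) =
    trans (pairInversions-∷ v r) (cong (count (Fin._<? v) r +_) (pairInversions≡inversions′ r))

inversions≡inversions′ : (σ : Perm n) → inversions σ ≡ inversions′ σ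
inversions≡inversions′ = pairInversions≡inversions′

parity≡0ℙ⇒2∣ : ∀ n → parity n ≡ 0ℙ → 2 ∣ n
parity≡0ℙ⇒2∣ zero          _    = 2 ∣0
parity≡0ℙ⇒2∣ (suc (suc n)) even = ∣m∣n⇒∣m+n ∣-refl (parity≡0ℙ⇒2∣ n even)

2∣⇒parity≡0ℙ : 2 ∣ n → parity n ≡ 0ℙ
2∣⇒parity≡0ℙ (divides q refl) = trans (ℙ.*-homo-* q 2) (ℙ.*-zeroʳ (parity q))

¬2∣⇒parity≡1ℙ : ¬ 2 ∣ n → parity n ≡ 1ℙ
¬2∣⇒parity≡1ℙ {n} odd with parity n in eq
... | 0ℙ = contradiction (parity≡0ℙ⇒2∣ n eq) odd
... | 1ℙ = refl

module _ {P : Pred A 0ℓ} (P? : Decidable P) {x : A} {xs : Vec A k} where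

  count-accept : P x → count P? (x ∷ xs) ≡ suc (count P? xs)
  count-accept px with P? x
  ... | yes _  = refl
  ... | no ¬px = contradiction px ¬px

  count-reject : ¬ P x → count P? (x ∷ xs) ≡ count P? xs
  count-reject ¬px with P? x
  ... | yes px = contradiction px ¬px
  ... | no _   = refl

inversions′-transpose-< : {v w : Fin m} (r : Vec (Fin m) k) → v Fin.< w →
  inversions′ (w ∷ v ∷ r) ≡ suc (inversions′ (v ∷ w ∷ r))
inversions′-transpose-< {v = v} {w} r v<w = begin
  count (Fin._<? w) (v ∷ r) + (below-v + inversions′ r)
    ≡⟨ cong (_+ (below-v + inversions′ r)) (count-accept (Fin._<? w) {xs = r} v<w) ⟩
  suc (below-w + (below-v + inversions′ r))
    ≡⟨ cong suc (ℕ+.x∙yz≈y∙xz below-w below-v (inversions′ r)) ⟩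
  suc (below-v + (below-w + inversions′ r))
    ≡⟨ cong (λ c → suc (c + (below-w + inversions′ r))) (count-reject (Fin._<? v) {xs = r} (Fin.<-asym v<w)) ⟨
  suc (count (Fin._<? v) (w ∷ r) + (below-w + inversions′ r)) ∎
  where
  open ≡-Reasoning
  below-v = count (Fin._<? v) r
  below-w = count (Fin._<? w) r

parity-transpose : {v w : Fin m} (r : Vec (Fin m) k) → v ≢ w →
  parity (inversions′ (w ∷ v ∷ r)) ≡ 1ℙ ℙ.+ parity (inversions′ (v ∷ w ∷ r))
parity-transpose {v = v} {w} r v≢w with Fin.<-cmp v w
... | tri< v<w _ _ = trans (cong parity (inversions′-transpose-< r v<w)) (ℙ.+-homo-+ 1 (inversions′ (v ∷ w ∷ r)))
... | tri≈ _ v≡w _ = contradiction v≡w v≢w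
... | tri> _ _ w<v =
  sym (trans (cong (λ i → 1ℙ ℙ.+ parity i) (inversions′-transpose-< r w<v))
             (ℙ.suc-homo-⁻¹ (inversions′ (w ∷ v ∷ r))))

parity-moveHead : (M : Fin (suc k)) (v : Fin m) (r : Vec (Fin m) k) → VecAll.All (v ≢_) r →
  parity (inversions′ (moveHead M (v ∷ r))) ≡ parity (toℕ M) ℙ.+ parity (inversions′ (v ∷ r))
parity-moveHead zero    v r       _           = refl
parity-moveHead (suc M) v (w ∷ r) (v≢w ∷ v∉r) = begin
  parity (count (Fin._<? w) moved + inversions′ moved)
    ≡⟨ ℙ.+-homo-+ (count (Fin._<? w) moved) (inversions′ moved) ⟩
  parity (count (Fin._<? w) moved) ℙ.+ parity (inversions′ moved)
    ≡⟨ cong₂ ℙ._+_ (cong parity (count-moveHead _ M (v ∷ r))) (parity-moveHead M v r v∉r) ⟩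
  parity below-w ℙ.+ (pM ℙ.+ parity (inversions′ (v ∷ r)))
    ≡⟨ ℙ+.x∙yz≈y∙xz (parity below-w) pM _ ⟩
  pM ℙ.+ (parity below-w ℙ.+ parity (inversions′ (v ∷ r)))
    ≡⟨ cong (pM ℙ.+_) (ℙ.+-homo-+ below-w (inversions′ (v ∷ r))) ⟨
  pM ℙ.+ parity (inversions′ (w ∷ v ∷ r))
    ≡⟨ cong (pM ℙ.+_) (parity-transpose r v≢w) ⟩
  pM ℙ.+ (1ℙ ℙ.+ parity (inversions′ (v ∷ w ∷ r)))
    ≡⟨ ℙ+.x∙yz≈yx∙z pM 1ℙ _ ⟩
  (1ℙ ℙ.+ pM) ℙ.+ parity (inversions′ (v ∷ w ∷ r))
    ≡⟨ cong (ℙ._+ parity (inversions′ (v ∷ w ∷ r))) (ℙ.+-homo-+ 1 (toℕ M)) ⟨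
  parity (suc (toℕ M)) ℙ.+ parity (inversions′ (v ∷ w ∷ r)) ∎
  where
  open ≡-Reasoning
  moved   = moveHead M (v ∷ r)
  below-w = count (Fin._<? w) (v ∷ r)
  pM      = parity (toℕ M)

even⇒parity≡0ℙ : (σ : Perm n) → IsEven σ → parity (inversions′ σ) ≡ 0ℙ
even⇒parity≡0ℙ σ = 2∣⇒parity≡0ℙ ∘ subst (2 ∣_) (inversions≡inversions′ σ)

parity≡0ℙ⇒even : (σ : Perm n) → parity (inversions′ σ) ≡ 0ℙ → IsEven σ
parity≡0ℙ⇒even σ = subst (2 ∣_) (sym (inversions≡inversions′ σ)) ∘ parity≡0ℙ⇒2∣ _

odd⇒parity≡1ℙ : (σ : Perm n) → ¬ IsEven σ → parity (inversions′ σ) ≡ 1ℙ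
odd⇒parity≡1ℙ σ odd = ¬2∣⇒parity≡1ℙ (odd ∘ parity≡0ℙ⇒even σ ∘ 2∣⇒parity≡0ℙ {inversions′ σ})

moveHead-pres-even : (M : Fin (suc n)) {σ : Perm (suc n)} → VecUnique.Unique σ → 2 ∣ toℕ M → IsEven σ →
  IsEven (moveHead M σ)
moveHead-pres-even M {v ∷ r} (v∉r ∷ _) 2∣M σ-even = parity≡0ℙ⇒even (moveHead M (v ∷ r))
  (trans (parity-moveHead M v r v∉r) (cong₂ ℙ._+_ (2∣⇒parity≡0ℙ 2∣M) (even⇒parity≡0ℙ (v ∷ r) σ-even)))

odd⇒swap-even : {σ : Perm (suc (suc n))} → VecUnique.Unique σ → ¬ IsEven σ → IsEven (swap σ)
odd⇒swap-even {σ = v ∷ r} (v∉r ∷ _) σ-odd = parity≡0ℙ⇒even (swap (v ∷ r))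
  (trans (parity-moveHead (suc zero) v r v∉r) (cong (1ℙ ℙ.+_) (odd⇒parity≡1ℙ (v ∷ r) σ-odd)))

count-below-zero : (r : Vec (Fin (suc m)) k) → count (Fin._<? zero {n = m}) r ≡ 0
count-below-zero []      = refl
count-below-zero (w ∷ r) = count-below-zero r

count-map-suc : (v : Fin m) (r : Vec (Fin m) k) → count (Fin._<? suc v) (Vec.map suc r) ≡ count (Fin._<? v) r
count-map-suc v []      = refl
count-map-suc v (w ∷ r) with does (w Fin.<? v)
... | true  = cong suc (count-map-suc v r)
... | false = count-map-suc v r

inversions′-map-suc : (r : Vec (Fin m) k) → inversions′ (Vec.map suc r) ≡ inversions′ r
inversions′-map-suc []      = refl
inversions′-map-suc (v ∷ r) = cong₂ _+_ (count-map-suc v r) (inversions′-map-suc r)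

extend-zero-pres-even : (τ : Perm n) → IsEven τ → IsEven (extend zero τ)
extend-zero-pres-even τ = subst (2 ∣_) (begin
  inversions τ                 ≡⟨ inversions≡inversions′ τ ⟩
  inversions′ τ                ≡⟨ inversions′-map-suc τ ⟨
  inversions′ (Vec.map suc τ)  ≡⟨ cong (_+ inversions′ (Vec.map suc τ)) (count-below-zero (Vec.map suc τ)) ⟨
  inversions′ (extend zero τ)  ≡⟨ inversions≡inversions′ (extend zero τ) ⟨
  inversions (extend zero τ)   ∎)
  where open ≡-Reasoning

isEven? : Decidable (IsEven {n})
isEven? σ = 2 ∣? inversions σ

evens : ∀ n → List (Perm n)
evens n = filter isEven? (perms n)

evens-entries : ∀ n → All (λ σ → VecUnique.Unique σ × IsEven σ) (evens n)
evens-entries n = All.tabulate (Product.map₁ ∈-perms⇒unique ∘ ∈-filter⁻ isEven?)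

n!≤2*length-evens : ∀ n → n ! ≤ 2 * length (evens n)
n!≤2*length-evens zero          = s≤s z≤n
n!≤2*length-evens (suc zero)    = s≤s z≤n
n!≤2*length-evens (suc (suc n)) = begin
  suc (suc n) !                  ≡⟨ length-perms (suc (suc n)) ⟨
  length (perms (suc (suc n)))   ≡⟨ length-filter+length-filter-¬ isEven? (perms (suc (suc n))) ⟩
  length even + length odd       ≤⟨ ℕ.+-monoʳ-≤ (length even) odd≤even ⟩
  length even + length even      ≡⟨ cong (length even +_) (ℕ.+-identityʳ (length even)) ⟨
  2 * length even                ∎
  where
  open ℕ.≤-Reasoning
  even = evens (suc (suc n))
  odd  = filter (¬? ∘ isEven?) (perms (suc (suc n)))

  swap-injective : ∀ {σ ρ} → σ ∈ odd → ρ ∈ odd → swap σ ≡ swap ρ → σ ≡ ρ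
  swap-injective {_ ∷ _ ∷ _} {_ ∷ _ ∷ _} _ _ = cong swap

  swap-odd∈even : ∀ {σ} → σ ∈ odd → swap σ ∈ even
  swap-odd∈even σ∈odd with σ∈perms , σ-odd ← ∈-filter⁻ (¬? ∘ isEven?) σ∈odd =
    ∈-filter⁺ isEven? (unique⇒∈-perms (unique-moveHead _ σ-unique)) (odd⇒swap-even σ-unique σ-odd)
    where σ-unique = ∈-perms⇒unique σ∈perms

  odd≤even : length odd ≤ length even
  odd≤even = injectiveOn⇒length≤ (Unique.filter⁺ _ (perms-unique _)) swap-injective swap-odd∈even

reps2≤ : (S : List (Elt n)) → Unique S → (key : Elt n → B) (keys : List B) → (∀ {a} → a ∈ S → key a ∈ keys) →
  (∀ {a b a′ b′} → a ∈ S → b ∈ S → a′ ∈ S → b′ ∈ S → a · b ≡ a′ · b′ → key a ≡ key a′ → a ≡ a′ × b ≡ b′) →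
  ∀ μ → reps2 S μ ≤ length keys
reps2≤ S S-unique key keys key∈keys determined μ =
  injectiveOn⇒length≤ {f = key ∘ proj₁} words-unique first-key-injective (key∈keys ∘ proj₁ ∘ ∈-words⁻)
  where
  words = filter (λ w → (proj₁ w · proj₂ w) ≟ₑ μ) (cartesianProduct S S)

  words-unique : Unique words
  words-unique = Unique.filter⁺ _ (Unique.cartesianProduct⁺ S-unique S-unique)

  ∈-words⁻ : ∀ {w} → w ∈ words → proj₁ w ∈ S × proj₂ w ∈ S × proj₁ w · proj₂ w ≡ μ
  ∈-words⁻ w∈words with w∈S² , ab≡μ ← ∈-filter⁻ (λ w → (proj₁ w · proj₂ w) ≟ₑ μ) w∈words =
    ∈-cartesianProduct⁻ S S w∈S² .proj₁ , ∈-cartesianProduct⁻ S S w∈S² .proj₂ , ab≡μ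

  first-key-injective : ∀ {w w′} → w ∈ words → w′ ∈ words → key (proj₁ w) ≡ key (proj₁ w′) → w ≡ w′
  first-key-injective w∈ w′∈ same-key
    with a∈ , b∈ , ab≡μ ← ∈-words⁻ w∈ | a′∈ , b′∈ , a′b′≡μ ← ∈-words⁻ w′∈
    with refl , refl ← determined a∈ b∈ a′∈ b′∈ (trans ab≡μ (sym a′b′≡μ)) same-key = refl

-- The embedding x ↦ (x , x δ)

evenFloor : (m : ℕ) → Fin (suc m)
evenFloor zero          = zero
evenFloor (suc zero)    = zero
evenFloor (suc (suc m)) = suc (suc (evenFloor m))

2∣evenFloor : ∀ m → 2 ∣ toℕ (evenFloor m)
2∣evenFloor zero          = 2 ∣0
2∣evenFloor (suc zero)    = 2 ∣0
2∣evenFloor (suc (suc m)) = ∣m∣n⇒∣m+n ∣-refl (2∣evenFloor m)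

≤1+evenFloor : ∀ m → m ≤ suc (toℕ (evenFloor m))
≤1+evenFloor zero          = z≤n
≤1+evenFloor (suc zero)    = s≤s z≤n
≤1+evenFloor (suc (suc m)) = s≤s (s≤s (≤1+evenFloor m))

module Embedding (m : ℕ) where

  M : Fin (suc m)
  M = evenFloor m

  δ : Perm (suc m)
  δ = moveHead M (Vec.allFin (suc m))

  δ-perm : IsPerm δ
  δ-perm = VecUnique.lookup-injective (unique-moveHead M (VecUnique.tabulate⁺ id))

  δ-suc : (i : Fin m) → toℕ i ℕ.< toℕ M → lookup δ (inject₁ i) ≡ suc i
  δ-suc i i<M = trans (lookup-moveHead M _ i i<M) (Vec.lookup-allFin (suc i))

  ∘δ≡moveHead : (x : Perm (suc m)) → x ∘ₚ δ ≡ moveHead M x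
  ∘δ≡moveHead x = begin
    Vec.tabulate (lookup x ∘ lookup δ)                   ≡⟨ Vec.tabulate-∘ (lookup x) (lookup δ) ⟩
    Vec.map (lookup x) (Vec.tabulate (lookup δ))         ≡⟨ cong (Vec.map (lookup x)) (Vec.tabulate∘lookup δ) ⟩
    Vec.map (lookup x) δ                                 ≡⟨ map-moveHead (lookup x) M (Vec.allFin (suc m)) ⟩
    moveHead M (Vec.map (lookup x) (Vec.allFin (suc m))) ≡⟨ cong (moveHead M) (Vec.map-lookup-allFin x) ⟩
    moveHead M x                                         ∎
    where open ≡-Reasoning

  embed : Perm (suc m) → Elt (suc m)
  embed x = x , x ∘ₚ δ

  embed-injective : Injective _≡_ _≡_ embed
  embed-injective = cong proj₁

  embed-InSS : {x : Perm (suc m)} → VecUnique.Unique x → InSS (embed x)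
  embed-InSS {x} x-unique =
    VecUnique.lookup-injective x-unique ,
    subst IsPerm (sym (∘δ≡moveHead x)) (VecUnique.lookup-injective (unique-moveHead M x-unique))

  embed-InAA : {x : Perm (suc m)} → VecUnique.Unique x → IsEven x → InAA (embed x)
  embed-InAA {x} x-unique x-even =
    (proj₁ (embed-InSS x-unique) , x-even) ,
    (proj₂ (embed-InSS x-unique) , subst IsEven (sym (∘δ≡moveHead x)) (moveHead-pres-even M x-unique (2∣evenFloor m) x-even))

  ≢fromℕ⇒≤M : (j : Fin (suc m)) → j ≢ fromℕ m → toℕ j ≤ toℕ M
  ≢fromℕ⇒≤M j j≢last = ℕ.≤-pred (ℕ.≤-trans j<m (≤1+evenFloor m))
    where
    j<m : toℕ j ℕ.< m
    j<m = ℕ.≤∧≢⇒< (Fin.toℕ≤pred[n] j)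
                   (λ j≡m → j≢last (Fin.toℕ-injective (trans j≡m (sym (Fin.toℕ-fromℕ m)))))

  factors-determined : {x y x′ y′ : Perm (suc m)} → VecUnique.Unique x → VecUnique.Unique y → VecUnique.Unique x′ →
    lookup x zero ≡ lookup x′ zero → embed x · embed y ≡ embed x′ · embed y′ → x ≡ x′ × y ≡ y′
  factors-determined {x} {y} {x′} {y′} x-unique y-unique x′-unique x0≡x′0 xy≡x′y′ = x≡x′ , y≡y′
    where
    x′-perm = VecUnique.lookup-injective x′-unique

    xy : ∀ i → lookup x (lookup y i) ≡ lookup x′ (lookup y′ i)
    xy i = trans (sym (lookup-∘ₚ x y i))
                 (trans (cong (λ σ → lookup σ i) (cong proj₁ xy≡x′y′)) (lookup-∘ₚ x′ y′ i))

    xδyδ : ∀ i → lookup x (lookup δ (lookup y (lookup δ i))) ≡ lookup x′ (lookup δ (lookup y′ (lookup δ i)))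
    xδyδ i = trans (sym (lookup-∘ₚ-∘ₚ x δ y δ i))
                   (trans (cong (λ σ → lookup σ i) (cong proj₂ xy≡x′y′)) (lookup-∘ₚ-∘ₚ x′ δ y′ δ i))

    agree-upto-M : ∀ j → toℕ j ≤ toℕ M → lookup x j ≡ lookup x′ j
    agree-upto-M = <-weakInduction (λ j → toℕ j ≤ toℕ M → lookup x j ≡ lookup x′ j) (λ _ → x0≡x′0) step
      where
      step : ∀ i → (toℕ (inject₁ i) ≤ toℕ M → lookup x (inject₁ i) ≡ lookup x′ (inject₁ i)) →
        suc (toℕ i) ≤ toℕ M → lookup x (suc i) ≡ lookup x′ (suc i)
      step i agree-at-i i<M = subst (λ j → lookup x j ≡ lookup x′ j) (δ-suc i i<M)
        (agreement-propagates {x = lookup x} {lookup y} {lookup x′} {lookup y′} {lookup δ}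
          (perm-surjective δ δ-perm) (perm-surjective y (VecUnique.lookup-injective y-unique)) (x′-perm _ _) xy xδyδ
          (agree-at-i (ℕ.≤-trans (ℕ.≤-reflexive (Fin.toℕ-inject₁ i)) (ℕ.<⇒≤ i<M))))

    x≡x′ : x ≡ x′
    x≡x′ = lookup-ext (agree-off-point⇒agree {x = lookup x} {lookup x′} (VecUnique.lookup-injective x-unique _ _)
                        (perm-surjective x′ x′-perm) (fromℕ m) (λ j j≢last → agree-upto-M j (≢fromℕ⇒≤M j j≢last)))

    y≡y′ : y ≡ y′
    y≡y′ = lookup-ext (λ i → x′-perm _ _ (trans (cong (λ σ → lookup σ (lookup y i)) (sym x≡x′)) (xy i)))

  embed-isS2g : {InΓ : Elt (suc m) → Set} {g : ℕ} (L : List (Perm (suc m))) (keys : List (Fin (suc m))) →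
    Unique L → All VecUnique.Unique L → All (InΓ ∘ embed) L → All (λ x → lookup x zero ∈ keys) L → length keys ≤ g →
    IsS2g InΓ g (map embed L)
  embed-isS2g L keys L-unique L-entries L-InΓ L-keys keys≤g =
    S-unique , All.map⁺ L-InΓ ,
    λ μ _ → ℕ.≤-trans (reps2≤ S S-unique (λ a → lookup (proj₁ a) zero) keys key∈keys determined μ) keys≤g
    where
    S = map embed L
    S-unique = Unique.map⁺ embed-injective L-unique

    key∈keys : ∀ {a} → a ∈ S → lookup (proj₁ a) zero ∈ keys
    key∈keys a∈S with x , x∈L , refl ← ∈-map⁻ embed a∈S = All.lookup L-keys x∈L

    determined : ∀ {a b a′ b′} → a ∈ S → b ∈ S → a′ ∈ S → b′ ∈ S → a · b ≡ a′ · b′ →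
      lookup (proj₁ a) zero ≡ lookup (proj₁ a′) zero → a ≡ a′ × b ≡ b′
    determined a∈S b∈S a′∈S b′∈S ab≡a′b′ same-key
      with x , x∈L , refl ← ∈-map⁻ embed a∈S | y , y∈L , refl ← ∈-map⁻ embed b∈S
         | x′ , x′∈L , refl ← ∈-map⁻ embed a′∈S | y′ , y′∈L , refl ← ∈-map⁻ embed b′∈S
      with refl , refl ← factors-determined {y′ = y′} (All.lookup L-entries x∈L) (All.lookup L-entries y∈L)
                                                      (All.lookup L-entries x′∈L) same-key ab≡a′b′ = refl , refl

  fixing-zero-isS2g : ∀ {InΓ : Elt (suc m) → Set} (T : List (Perm m)) → Unique T → All VecUnique.Unique T →
    All (InΓ ∘ embed ∘ extend zero) T → IsS2g InΓ 1 (map embed (map (extend zero) T))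
  fixing-zero-isS2g T T-unique T-entries T-InΓ =
    embed-isS2g (map (extend zero) T) (zero ∷ []) (Unique.map⁺ (cong proj₂ ∘ extend-injective) T-unique)
      (All.map⁺ (All.map (extend-unique zero) T-entries)) (All.map⁺ T-InΓ) (All.map⁺ (All.universal (λ _ → here refl) T))
      ℕ.≤-refl

  all-isS2g : ∀ {InΓ : Elt (suc m) → Set} (L : List (Perm (suc m))) → Unique L → All VecUnique.Unique L →
    All (InΓ ∘ embed) L → IsS2g InΓ (suc m) (map embed L)
  all-isS2g L L-unique L-entries L-InΓ =
    embed-isS2g L (allFin (suc m)) L-unique L-entries L-InΓ (All.universal (λ _ → ∈-allFin _) L)
      (ℕ.≤-reflexive (List.length-tabulate id))

  S₂-set : Σ (List (Elt (suc m))) λ A → IsS2g InSS 1 A × m ! ≤ length A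
  S₂-set =
    map embed (map (extend zero) (perms m)) ,
    fixing-zero-isS2g (perms m) (perms-unique m) (perms-entries-unique m)
      (All.map (embed-InSS ∘ extend-unique zero) (perms-entries-unique m)) ,
    ℕ.≤-reflexive (sym (begin
      length (map embed (map (extend zero) (perms m))) ≡⟨ List.length-map embed (map (extend zero) (perms m)) ⟩
      length (map (extend zero) (perms m))             ≡⟨ List.length-map (extend zero) (perms m) ⟩
      length (perms m)                                 ≡⟨ length-perms m ⟩
      m !                                              ∎))
    where open ≡-Reasoning

  S₂[n]-set : Σ (List (Elt (suc m))) λ A → IsS2g InSS (suc m) A × suc m ! ≤ length A
  S₂[n]-set =
    map embed (perms (suc m)) ,
    all-isS2g (perms (suc m)) (perms-unique (suc m)) (perms-entries-unique (suc m))
      (All.map embed-InSS (perms-entries-unique (suc m))) ,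
    ℕ.≤-reflexive (sym (trans (List.length-map embed (perms (suc m))) (length-perms (suc m))))

  alternating-S₂-set : Σ (List (Elt (suc m))) λ A → IsS2g InAA 1 A × m ! ≤ 2 * length A
  alternating-S₂-set =
    map embed (map (extend zero) (evens m)) ,
    fixing-zero-isS2g (evens m) (Unique.filter⁺ isEven? (perms-unique m)) (All.map proj₁ (evens-entries m))
      (All.map (λ {τ} (τ-unique , τ-even) → embed-InAA (extend-unique zero τ-unique) (extend-zero-pres-even τ τ-even))
               (evens-entries m)) ,
    subst (λ l → m ! ≤ 2 * l)
      (sym (trans (List.length-map embed (map (extend zero) (evens m))) (List.length-map (extend zero) (evens m))))
      (n!≤2*length-evens m)

  alternating-S₂[n]-set : Σ (List (Elt (suc m))) λ A → IsS2g InAA (suc m) A × suc m ! ≤ 2 * length A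
  alternating-S₂[n]-set =
    map embed (evens (suc m)) ,
    all-isS2g (evens (suc m)) (Unique.filter⁺ isEven? (perms-unique (suc m))) (All.map proj₁ (evens-entries (suc m)))
      (All.map (Product.uncurry embed-InAA) (evens-entries (suc m))) ,
    subst (λ l → suc m ! ≤ 2 * l) (sym (List.length-map embed (evens (suc m)))) (n!≤2*length-evens (suc m))

theorem1p8 : (n : ℕ) → 1 ≤ n →
    (Σ (List (Elt n)) λ A → IsS2g InSS 1 A × (n ∸ 1) ! ≤ length A)
    × (Σ (List (Elt n)) λ A → IsS2g InSS n A × n ! ≤ length A)
    × (Σ (List (Elt n)) λ A → IsS2g InAA 1 A × (n ∸ 1) ! ≤ 2 * length A)
    × (Σ (List (Elt n)) λ A → IsS2g InAA n A × n ! ≤ 2 * length A)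
theorem1p8 (suc m) _ = S₂-set , S₂[n]-set , alternating-S₂-set , alternating-S₂[n]-set
  where open Embedding m
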